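{- Let $O_n$ be the ortho-chain square cactus with $n$ squares. Then for every $n\ge 1$ and $k\ge 1$: (i) $Mo(O_n)=36k^2-12k$ if $n=2k$, and $Mo(O_n)=36k^2+24k$ if $n=2k+1$; (ii) $Mo_e(O_n)=48k^2-16k$ if $n=2k$, and $Mo_e(O_n)=48k^2+32k$ if $n=2k+1$.
   Context: The ortho-chain square cactus $O_n$ consists of $n$ 4-cycles (squares) $S_1,\ldots,S_n$ such that $S_i$ and $S_{i+1}$ share exactly one vertex for $i=1,\ldots,n-1$, non-consecutive squares are vertex-disjoint, and for $2\le i\le n-1$ the vertex $S_i$ shares with $S_{i-1}$ and the vertex it shares with $S_{i+1}$ are adjacent vertices of $S_i$. For a graph $G$ and an edge $e=uv$, $n_u(e,G)$ denotes the number of vertices of $G$ strictly closer to $u$ than to $v$ (and $n_v(e,G)$ analogously). The Mostar index is $Mo(G)=\sum_{uv\in E(G)}|n_u(uv,G)-n_v(uv,G)|$. For a vertex $w$ and an edge $f=ab$ put $d(w,f)=\min\{d(w,a),d(w,b)\}$; $m_u(e|G)$ is the number of edges $f$ of $G$ with $d(u,f)<d(v,f)$, and $m_v(e|G)$ analogously. The edge Mostar index is $Mo_e(G)=\sum_{e=uv\in E(G)}|m_u(e|G)-m_v(e|G)|$. -}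

module Defs where

open import Data.Nat using (ℕ; zero; suc; _+_; _*_; _∸_; _<ᵇ_; _≡ᵇ_; _⊔_; _⊓_; ∣_-_∣)
open import Data.Bool using (Bool; true; false; _∨_; _∧_; not; if_then_else_)
open import Data.List using (List; []; _∷_; map; filter; length; upTo; concatMap)
open import Data.Nat.ListAction using (sum)
open import Data.Bool.ListAction using (any)
open import Data.Product using (_×_; _,_; proj₁; proj₂)
open import Relation.Nullary.Decidable using (yes; no)
open import Relation.Binary.PropositionalEquality using (_≡_)
open import Data.Bool.Properties using (T?)
open import Data.Bool using (T)

-- A finite (simple, undirected) graph: vertex set {0, …, size-1},
-- edge set given as a list of unordered pairs (each edge listed once).
record Graph : Set where
  constructor graph
  field
    size  : ℕ
    edges : List (ℕ × ℕ)
open Graph public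

vertices : Graph → List ℕ
vertices G = upTo (size G)

walkWithin : Graph → ℕ → ℕ → ℕ → Bool
walkWithin G zero    u v = u ≡ᵇ v
walkWithin G (suc k) u v =
  walkWithin G k u v ∨
  any (λ e → ((proj₁ e ≡ᵇ u) ∧ walkWithin G k (proj₂ e) v)
           ∨ ((proj₂ e ≡ᵇ u) ∧ walkWithin G k (proj₁ e) v)) (edges G)

-- Shortest-path distance: the least k with a walk of length ≤ k
-- (= number of k < size G for which no walk of length ≤ k exists;
-- walkWithin is monotone in k and every distance in a connected graph is < size G).
dist : Graph → ℕ → ℕ → ℕ
dist G u v = length (filter (λ k → T? (not (walkWithin G k u v))) (upTo (size G)))

countL : {A : Set} → (A → Bool) → List A → ℕ
countL p xs = length (filter (λ x → T? (p x)) xs)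

nVert : Graph → ℕ → ℕ → ℕ
nVert G u v = countL (λ w → dist G w u <ᵇ dist G w v) (vertices G)

Mo : Graph → ℕ
Mo G = sum (map (λ e → ∣ nVert G (proj₁ e) (proj₂ e) - nVert G (proj₂ e) (proj₁ e) ∣) (edges G))

distVE : Graph → ℕ → ℕ × ℕ → ℕ
distVE G w f = dist G w (proj₁ f) ⊓ dist G w (proj₂ f)

mEdge : Graph → ℕ → ℕ → ℕ
mEdge G u v = countL (λ f → distVE G u f <ᵇ distVE G v f) (edges G)

Moe : Graph → ℕ
Moe G = sum (map (λ e → ∣ mEdge G (proj₁ e) (proj₂ e) - mEdge G (proj₂ e) (proj₁ e) ∣) (edges G))

-- Ortho-chain square cactus O_n on 3n+1 vertices:
--   cut vertices c_i = i           (0 ≤ i ≤ n),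
--   x_i = n + i, y_i = 2n + i      (1 ≤ i ≤ n).
-- Square S_i is the 4-cycle c_{i-1} – c_i – x_i – y_i – c_{i-1}.
-- S_i ∩ S_{i+1} = {c_i}, and c_{i-1}, c_i are adjacent in S_i (ortho condition).
squareEdges : ℕ → ℕ → List (ℕ × ℕ)
squareEdges n i =
  (i , suc i) ∷ (suc i , n + suc i) ∷ (n + suc i , n + n + suc i) ∷ (n + n + suc i , i) ∷ []
-- (squareEdges n i describes S_{i+1}, for 0 ≤ i < n)

orthoChain : ℕ → Graph
orthoChain n = graph (3 * n + 1) (concatMap (squareEdges n) (upTo n))

-- Put the cut vertex c_j at position j of a spine and the two other vertices of each
-- square directly above its two spine vertices. The distance in O_n is then the spine
-- distance plus a detour of at most 2, and this closed form agrees with the walk-based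
-- dist. Every edge uv splits the vertex set, and the edge set, into the parts closer to
-- u and to v: the spine edge and the top edge of a square both split it into the part
-- left and the part right of the square, its two vertical edges into the square's top
-- and everything else. Counting these parts, square j contributes 12 max(j, n-1-j) to
-- Mo and 16 max(j, n-1-j) to Mo_e, and the sum of max(j, n-1-j) over j < n is 3k^2 - k
-- for n = 2k and 3k^2 + 2k for n = 2k+1.

module Submission where

open import Data.Bool using (Bool; true; false; not; _∧_; _∨_; if_then_else_; T)
open import Data.Bool.Properties using (T-≡; T-∨; T-∧; ∨-zeroʳ)
open import Data.Bool.ListAction using (any; or)
open import Data.Empty using (⊥-elim)
open import Data.List using (List; []; _∷_; _++_; [_]; map; upTo; concatMap)
open import Data.List.Properties using (upTo-∷ʳ; map-++; map-cong-local)
open import Data.List.Membership.Propositional using (_∈_; find; lose)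
open import Data.List.Membership.Propositional.Properties using (∈-concatMap⁺; ∈-concatMap⁻; ∈-upTo⁺; ∈-upTo⁻)
open import Data.List.Relation.Unary.All using (tabulate)
open import Data.List.Relation.Unary.Any using (here; there)
open import Data.List.Relation.Unary.Any.Properties using (any⁺; any⁻)
open import Data.Nat using (ℕ; zero; suc; _+_; _*_; _∸_; _≤_; _<_; z≤n; s≤s; z<s; _<ᵇ_; _≡ᵇ_; _≤ᵇ_; ∣_-_∣; _⊓_; _⊔_)
open import Data.Nat.ListAction using (sum)
open import Data.Nat.ListAction.Properties using (sum-++)
open import Data.Nat.Properties
open import Data.Nat.Tactic.RingSolver using (solve-∀)
open import Data.Product using (_×_; _,_; proj₁; proj₂; ∃-syntax; swap)
open import Data.Sum using (_⊎_; inj₁; inj₂)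
open import Function using (_∘_; Equivalence)
open import Relation.Binary.Definitions using (tri<; tri≈; tri>)
open import Relation.Binary.PropositionalEquality hiding ([_])
open import Relation.Nullary using (yes; no)

open import Defs

open Equivalence using (to; from)

<ᵇ-true : ∀ {m n} → m < n → (m <ᵇ n) ≡ true
<ᵇ-true {zero}  {suc n} _       = refl
<ᵇ-true {suc m} {suc n} (s≤s p) = <ᵇ-true p

<ᵇ-false : ∀ {m n} → n ≤ m → (m <ᵇ n) ≡ false
<ᵇ-false {m}     {zero}  _       = refl
<ᵇ-false {suc m} {suc n} (s≤s p) = <ᵇ-false p

≤ᵇ-true : ∀ {m n} → m ≤ n → (m ≤ᵇ n) ≡ true
≤ᵇ-true {zero}  _ = refl
≤ᵇ-true {suc m} p = <ᵇ-true p

≤ᵇ-false : ∀ {m n} → n < m → (m ≤ᵇ n) ≡ false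
≤ᵇ-false {suc m} p = <ᵇ-false (≤-pred p)

≡ᵇ-refl : ∀ m → (m ≡ᵇ m) ≡ true
≡ᵇ-refl zero    = refl
≡ᵇ-refl (suc m) = ≡ᵇ-refl m

≡ᵇ-sym : ∀ m n → (m ≡ᵇ n) ≡ (n ≡ᵇ m)
≡ᵇ-sym zero    zero    = refl
≡ᵇ-sym zero    (suc n) = refl
≡ᵇ-sym (suc m) zero    = refl
≡ᵇ-sym (suc m) (suc n) = ≡ᵇ-sym m n

≡ᵇ-false : ∀ {m n} → m ≢ n → (m ≡ᵇ n) ≡ false
≡ᵇ-false {zero}  {zero}  m≢n = ⊥-elim (m≢n refl)
≡ᵇ-false {zero}  {suc n} _   = refl
≡ᵇ-false {suc m} {zero}  _   = refl
≡ᵇ-false {suc m} {suc n} m≢n = ≡ᵇ-false (m≢n ∘ cong suc)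

-- Finite sums

toℕ : Bool → ℕ
toℕ true  = 1
toℕ false = 0

sumBelow : (ℕ → ℕ) → ℕ → ℕ
sumBelow f zero    = 0
sumBelow f (suc N) = sumBelow f N + f N

sumBelow-cong : ∀ {f g} N → (∀ i → i < N → f i ≡ g i) → sumBelow f N ≡ sumBelow g N
sumBelow-cong zero    _   = refl
sumBelow-cong (suc N) f≡g = cong₂ _+_ (sumBelow-cong N (λ i i<N → f≡g i (m≤n⇒m≤1+n i<N))) (f≡g N ≤-refl)

sumBelow-+ : ∀ f g N → sumBelow (λ i → f i + g i) N ≡ sumBelow f N + sumBelow g N
sumBelow-+ f g zero    = refl
sumBelow-+ f g (suc N) = begin
  sumBelow (λ i → f i + g i) N + (f N + g N)   ≡⟨ cong (_+ (f N + g N)) (sumBelow-+ f g N) ⟩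
  sumBelow f N + sumBelow g N + (f N + g N)    ≡⟨ +-assoc-swap (sumBelow f N) (sumBelow g N) (f N) (g N) ⟩
  sumBelow f N + f N + (sumBelow g N + g N)    ∎
  where
  open ≡-Reasoning
  +-assoc-swap : ∀ a b c d → a + b + (c + d) ≡ a + c + (b + d)
  +-assoc-swap = solve-∀

sumBelow-*ˡ : ∀ c f N → sumBelow (λ i → c * f i) N ≡ c * sumBelow f N
sumBelow-*ˡ c f zero    = sym (*-zeroʳ c)
sumBelow-*ˡ c f (suc N) = trans (cong (_+ c * f N) (sumBelow-*ˡ c f N)) (sym (*-distribˡ-+ c (sumBelow f N) (f N)))

sumBelow-const : ∀ c N → sumBelow (λ _ → c) N ≡ N * c
sumBelow-const c zero    = refl
sumBelow-const c (suc N) = trans (cong (_+ c) (sumBelow-const c N)) (+-comm (N * c) c)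

sumBelow-split : ∀ f a b → sumBelow f (a + b) ≡ sumBelow f a + sumBelow (λ i → f (a + i)) b
sumBelow-split f a zero    = trans (cong (sumBelow f) (+-identityʳ a)) (sym (+-identityʳ _))
sumBelow-split f a (suc b) = begin
  sumBelow f (a + suc b)                                        ≡⟨ cong (sumBelow f) (+-suc a b) ⟩
  sumBelow f (a + b) + f (a + b)                                ≡⟨ cong (_+ f (a + b)) (sumBelow-split f a b) ⟩
  sumBelow f a + sumBelow (λ i → f (a + i)) b + f (a + b)       ≡⟨ +-assoc (sumBelow f a) _ _ ⟩
  sumBelow f a + sumBelow (λ i → f (a + i)) (suc b)             ∎
  where open ≡-Reasoning

sumBelow-suc : ∀ f N → sumBelow f (suc N) ≡ f 0 + sumBelow (f ∘ suc) N
sumBelow-suc f N = sumBelow-split f 1 N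

sumBelow-complement : ∀ (p : ℕ → Bool) N →
  sumBelow (λ i → toℕ (not (p i))) N ≡ N ∸ sumBelow (λ i → toℕ (p i)) N
sumBelow-complement p N = sym (trans (cong (_∸ sumBelow (toℕ ∘ p) N) (sym (partition N))) (m+n∸n≡m _ (sumBelow (toℕ ∘ p) N)))
  where
  toℕ-not : ∀ b → toℕ (not b) + toℕ b ≡ 1
  toℕ-not true  = refl
  toℕ-not false = refl
  partition : ∀ N → sumBelow (λ i → toℕ (not (p i))) N + sumBelow (toℕ ∘ p) N ≡ N
  partition N = begin
    sumBelow (λ i → toℕ (not (p i))) N + sumBelow (toℕ ∘ p) N ≡⟨ sym (sumBelow-+ _ _ N) ⟩
    sumBelow (λ i → toℕ (not (p i)) + toℕ (p i)) N            ≡⟨ sumBelow-cong N (λ i _ → toℕ-not (p i)) ⟩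
    sumBelow (λ _ → 1) N                                      ≡⟨ trans (sumBelow-const 1 N) (*-identityʳ N) ⟩
    N                                                         ∎
    where open ≡-Reasoning

sumBelow-<ᵇ : ∀ m N → sumBelow (λ i → toℕ (i <ᵇ m)) N ≡ N ⊓ m
sumBelow-<ᵇ m zero = refl
sumBelow-<ᵇ m (suc N) with N <? m
... | yes N<m rewrite sumBelow-<ᵇ m N | <ᵇ-true N<m | m≤n⇒m⊓n≡m (<⇒≤ N<m) | m≤n⇒m⊓n≡m N<m = +-comm N 1
... | no N≮m rewrite sumBelow-<ᵇ m N | <ᵇ-false (≮⇒≥ N≮m)
                   | m≥n⇒m⊓n≡n (≮⇒≥ N≮m) | m≥n⇒m⊓n≡n (m≤n⇒m≤1+n (≮⇒≥ N≮m)) = +-identityʳ m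

sumBelow-≡ᵇ-≤ : ∀ j N → N ≤ j → sumBelow (λ i → toℕ (i ≡ᵇ j)) N ≡ 0
sumBelow-≡ᵇ-≤ j zero    _     = refl
sumBelow-≡ᵇ-≤ j (suc N) 1+N≤j rewrite sumBelow-≡ᵇ-≤ j N (<⇒≤ 1+N≤j) | ≡ᵇ-false (<⇒≢ 1+N≤j) = refl

sumBelow-≡ᵇ : ∀ j N → j < N → sumBelow (λ i → toℕ (i ≡ᵇ j)) N ≡ 1
sumBelow-≡ᵇ j (suc N) j<1+N with j ≟ N
... | yes refl rewrite sumBelow-≡ᵇ-≤ j j ≤-refl | ≡ᵇ-refl j = refl
... | no j≢N   rewrite sumBelow-≡ᵇ j N (≤∧≢⇒< (≤-pred j<1+N) j≢N) | ≡ᵇ-false (j≢N ∘ sym) = refl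

sum-upTo : ∀ f N → sum (map f (upTo N)) ≡ sumBelow f N
sum-upTo f zero    = refl
sum-upTo f (suc N) = begin
  sum (map f (upTo (suc N)))      ≡⟨ cong (sum ∘ map f) (sym (upTo-∷ʳ N)) ⟩
  sum (map f (upTo N ++ [ N ]))   ≡⟨ cong sum (map-++ f (upTo N) [ N ]) ⟩
  sum (map f (upTo N) ++ [ f N ]) ≡⟨ sum-++ (map f (upTo N)) [ f N ] ⟩
  sum (map f (upTo N)) + (f N + 0) ≡⟨ cong₂ _+_ (sum-upTo f N) (+-identityʳ (f N)) ⟩
  sumBelow f N + f N              ∎
  where open ≡-Reasoning

sum-map-cong : ∀ {A : Set} {f g : A → ℕ} (xs : List A) → (∀ {x} → x ∈ xs → f x ≡ g x) →
  sum (map f xs) ≡ sum (map g xs)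
sum-map-cong xs f≡g = cong sum (map-cong-local (tabulate f≡g))

sum-concatMap : ∀ {A B : Set} (f : B → ℕ) (g : A → List B) xs →
  sum (map f (concatMap g xs)) ≡ sum (map (λ x → sum (map f (g x))) xs)
sum-concatMap f g []       = refl
sum-concatMap f g (x ∷ xs) = begin
  sum (map f (g x ++ concatMap g xs))           ≡⟨ cong sum (map-++ f (g x) (concatMap g xs)) ⟩
  sum (map f (g x) ++ map f (concatMap g xs))   ≡⟨ sum-++ (map f (g x)) _ ⟩
  sum (map f (g x)) + sum (map f (concatMap g xs)) ≡⟨ cong (sum (map f (g x)) +_) (sum-concatMap f g xs) ⟩
  sum (map f (g x)) + sum (map (λ x → sum (map f (g x))) xs) ∎
  where open ≡-Reasoning

countL-sum : ∀ {A : Set} (p : A → Bool) xs → countL p xs ≡ sum (map (toℕ ∘ p) xs)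
countL-sum p []       = refl
countL-sum p (x ∷ xs) with p x
... | true  = cong suc (countL-sum p xs)
... | false = countL-sum p xs

countL-sumBelow : ∀ (p : ℕ → Bool) N → countL p (upTo N) ≡ sumBelow (toℕ ∘ p) N
countL-sumBelow p N = trans (countL-sum p (upTo N)) (sum-upTo (toℕ ∘ p) N)

-- Coordinates

record Pt : Set where
  constructor pt
  field
    pos      : ℕ
    offSpine : Bool
    square   : ℕ
open Pt

-- Two off-spine vertices of one square are joined by its top edge; otherwise every
-- off-spine endpoint costs one vertical step.
detour : Bool → ℕ → Bool → ℕ → ℕ
detour true  s true  s′ = if s ≡ᵇ s′ then 0 else 2
detour true  _ false _  = 1
detour false _ true  _  = 1
detour false _ false _  = 0

δ : Pt → Pt → ℕ
δ P Q = ∣ pos P - pos Q ∣ + detour (offSpine P) (square P) (offSpine Q) (square Q)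

δ-sym : ∀ P Q → δ P Q ≡ δ Q P
δ-sym P Q = cong₂ _+_ (∣-∣-comm (pos P) (pos Q)) (detour-sym (offSpine P) (square P) (offSpine Q) (square Q))
  where
  detour-sym : ∀ a s b s′ → detour a s b s′ ≡ detour b s′ a s
  detour-sym true  s true  s′ rewrite ≡ᵇ-sym s s′ = refl
  detour-sym true  _ false _  = refl
  detour-sym false _ true  _  = refl
  detour-sym false _ false _  = refl

δ-self : ∀ P → δ P P ≡ 0
δ-self (pt p true  s) rewrite ∣n-n∣≡0 p | ≡ᵇ-refl s = refl
δ-self (pt p false s) rewrite ∣n-n∣≡0 p = refl

detour≤2 : ∀ a s b s′ → detour a s b s′ ≤ 2
detour≤2 true  s true  s′ with s ≡ᵇ s′
... | true  = z≤n
... | false = ≤-refl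
detour≤2 true  _ false _ = s≤s z≤n
detour≤2 false _ true  _ = s≤s z≤n
detour≤2 false _ false _ = z≤n

data OffByOne (x y : ℕ) : Bool → Set where
  below : y ≡ suc x → OffByOne x y true
  above : x ≡ suc y → OffByOne x y false

offByOne-swap : ∀ {x y b} → OffByOne x y b → OffByOne y x (not b)
offByOne-swap (below eq) = above eq
offByOne-swap (above eq) = below eq

offByOne-<ᵇ : ∀ {x y b} → OffByOne x y b → (x <ᵇ y) ≡ b
offByOne-<ᵇ {x}     (below refl) = <ᵇ-true (n<1+n x)
offByOne-<ᵇ {y = y} (above refl) = <ᵇ-false (n≤1+n y)

-- If one endpoint of an edge is closer to A and the other to B, the two minima coincide.
min-offByOne : ∀ {x₁ y₁ x₂ y₂ b₁ b₂} → OffByOne x₁ y₁ b₁ → OffByOne x₂ y₂ b₂ →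
  x₁ ≤ suc x₂ → x₂ ≤ suc x₁ → y₁ ≤ suc y₂ → y₂ ≤ suc y₁ → ((x₁ ⊓ x₂) <ᵇ (y₁ ⊓ y₂)) ≡ (b₁ ∧ b₂)
min-offByOne {x₁} {_} {x₂} (below refl) (below refl) _ _ _ _ = <ᵇ-true (n<1+n (x₁ ⊓ x₂))
min-offByOne {_} {y₁} {_} {y₂} (above refl) (above refl) _ _ _ _ = <ᵇ-false (n≤1+n (y₁ ⊓ y₂))
min-offByOne {x₁} (below refl) (above refl) _ x₂≤1+x₁ 1+x₁≤1+y₂ _
  with ≤-antisym (≤-pred 1+x₁≤1+y₂) (≤-pred x₂≤1+x₁)
... | refl rewrite m≤n⇒m⊓n≡m (n≤1+n x₁) | m≥n⇒m⊓n≡n (n≤1+n x₁) = <ᵇ-false (≤-refl {x₁})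
min-offByOne {_} {y₁} (above refl) (below refl) x₁≤1+x₂ _ _ y₂≤1+y₁
  with ≤-antisym (≤-pred x₁≤1+x₂) (≤-pred y₂≤1+y₁)
... | refl rewrite m≤n⇒m⊓n≡m (n≤1+n y₁) | m≥n⇒m⊓n≡n (n≤1+n y₁) = <ᵇ-false (≤-refl {y₁})

Separates : Pt → Pt → (Pt → Bool) → Set
Separates A B S = ∀ W → OffByOne (δ W A) (δ W B) (S W)

separates-swap : ∀ {A B S} → Separates A B S → Separates B A (not ∘ S)
separates-swap sep W = offByOne-swap (sep W)

separates-true : ∀ {A B S} → Separates A B S → ∀ W → S W ≡ true → δ B W ≡ suc (δ A W)
separates-true {A} {B} {S} sep W SW with S W | sep W
... | true | below eq = trans (δ-sym B W) (trans eq (cong suc (δ-sym W A)))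

separates-false : ∀ {A B S} → Separates A B S → ∀ W → S W ≡ false → δ A W ≡ suc (δ B W)
separates-false {A} {B} {S} sep W SW with S W | sep W
... | false | above eq = trans (δ-sym A W) (trans eq (cong suc (δ-sym W B)))

separates-lipschitz : ∀ {A B S} → Separates A B S → ∀ W → δ A W ≤ suc (δ B W) × δ B W ≤ suc (δ A W)
separates-lipschitz {A} {B} sep W rewrite δ-sym A W | δ-sym B W = offByOne-lipschitz (sep W)
  where
  offByOne-lipschitz : ∀ {x y b} → OffByOne x y b → x ≤ suc y × y ≤ suc x
  offByOne-lipschitz (below refl) = m≤n⇒m≤1+n (n≤1+n _) , ≤-refl
  offByOne-lipschitz (above refl) = ≤-refl , m≤n⇒m≤1+n (n≤1+n _)

∣m-1+n∣≡1+∣m-n∣ : ∀ {m n} → m ≤ n → ∣ m - suc n ∣ ≡ suc ∣ m - n ∣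
∣m-1+n∣≡1+∣m-n∣ {zero}  {zero}  _         = refl
∣m-1+n∣≡1+∣m-n∣ {zero}  {suc n} _         = refl
∣m-1+n∣≡1+∣m-n∣ {suc m} {suc n} (s≤s m≤n) = ∣m-1+n∣≡1+∣m-n∣ m≤n

∣m-n∣≡1+∣m-1+n∣ : ∀ {m n} → n < m → ∣ m - n ∣ ≡ suc ∣ m - suc n ∣
∣m-n∣≡1+∣m-1+n∣ {suc m} {zero}  _         = cong suc (sym (∣-∣-identityʳ m))
∣m-n∣≡1+∣m-1+n∣ {suc m} {suc n} (s≤s n<m) = ∣m-n∣≡1+∣m-1+n∣ n<m

separates-along : ∀ q t s → Separates (pt q t s) (pt (suc q) t s) (λ W → pos W <ᵇ suc q)
separates-along q t s (pt p t′ s′) with p ≤? q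
... | yes p≤q rewrite <ᵇ-true (s≤s p≤q) | ∣m-1+n∣≡1+∣m-n∣ p≤q = below refl
... | no p≰q  rewrite <ᵇ-false {p} {suc q} (≰⇒> p≰q) | ∣m-n∣≡1+∣m-1+n∣ (≰⇒> p≰q) = above refl

separates-above : ∀ q s → Separates (pt q true s) (pt q false 0) (λ W → offSpine W ∧ (square W ≡ᵇ s))
separates-above q s (pt p false s′) = above (+-suc ∣ p - q ∣ 0)
separates-above q s (pt p true  s′) with s′ ≡ᵇ s
... | true  = below (+-suc ∣ p - q ∣ 0)
... | false = above (+-suc ∣ p - q ∣ 1)

coords : ℕ → ℕ → Pt
coords n w =
  if n <ᵇ w
  then (if (n + n) <ᵇ w then pt (w ∸ suc (n + n)) true (w ∸ (n + n)) else pt (w ∸ n) true (w ∸ n))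
  else pt w false 0

coordDist : ℕ → ℕ → ℕ → ℕ
coordDist n u v = δ (coords n u) (coords n v)

-- isC j is c_j, while isX j and isY j are x_{j+1} and y_{j+1} of S_{j+1}.
data VertexOf (n : ℕ) : ℕ → Set where
  isC : ∀ j → j ≤ n → VertexOf n j
  isX : ∀ j → j < n → VertexOf n (n + suc j)
  isY : ∀ j → j < n → VertexOf n (n + n + suc j)

-- S_{j+1} spans the spine positions j and j+1; x_{j+1} lies over c_{j+1} and
-- y_{j+1} over c_j, and both carry the square index j+1.
coordsOf : ∀ {n w} → VertexOf n w → Pt
coordsOf (isC j _) = pt j false 0
coordsOf (isX j _) = pt (suc j) true (suc j)
coordsOf (isY j _) = pt j true (suc j)

coords-vertex : ∀ {n w} (v : VertexOf n w) → coords n w ≡ coordsOf v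
coords-vertex {n} (isC j j≤n) rewrite <ᵇ-false {n} {j} j≤n = refl
coords-vertex {n} (isX j j<n)
  rewrite <ᵇ-true (m<m+n n {suc j} z<s) | <ᵇ-false {n + n} {n + suc j} (+-monoʳ-≤ n j<n)
        | m+n∸m≡n n (suc j) = refl
coords-vertex {n} (isY j j<n)
  rewrite <ᵇ-true {n} {n + n + suc j} (<-≤-trans (m<m+n n {suc j} z<s) (+-monoˡ-≤ (suc j) (m≤m+n n n)))
        | <ᵇ-true (m<m+n (n + n) {suc j} z<s) | m+n∸m≡n (n + n) (suc j)
        | +-suc (n + n) j | m+n∸m≡n (n + n) j = refl

pos≤n : ∀ {n w} (v : VertexOf n w) → pos (coordsOf v) ≤ n
pos≤n (isC j j≤n) = j≤n
pos≤n (isX j j<n) = j<n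
pos≤n (isY j j<n) = <⇒≤ j<n

vertexOf : ∀ {n w} → w < 3 * n + 1 → VertexOf n w
vertexOf {n} {w} w<3n+1 with w ≤? n
... | yes w≤n = isC w w≤n
... | no w≰n with m≤n⇒∃[o]m+o≡n (≰⇒> w≰n)
...   | j , refl with suc j ≤? n
...     | yes j<n = subst (VertexOf n) (+-suc n j) (isX j j<n)
...     | no j≮n with m≤n⇒∃[o]m+o≡n (≤-pred (≰⇒> j≮n))
...       | i , refl = subst (VertexOf n) (e₀ n i) (isY i i<n)
  where
  e₀ : ∀ n i → n + n + suc i ≡ suc n + (n + i)
  e₀ = solve-∀
  e₁ : ∀ n i → suc (suc n + (n + i)) ≡ suc (n + n + suc i)
  e₁ = solve-∀
  e₂ : ∀ n → 3 * n + 1 ≡ suc (n + n + n)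
  e₂ = solve-∀
  i<n : i < n
  i<n = +-cancelˡ-≤ (n + n) (suc i) n (≤-pred (subst₂ _≤_ (e₁ n i) (e₂ n) w<3n+1))

∈-squareEdges : ∀ {n e} j → j < n → e ∈ squareEdges n j → e ∈ edges (orthoChain n)
∈-squareEdges {n} j j<n e∈ = ∈-concatMap⁺ (squareEdges n) (lose (∈-upTo⁺ j<n) e∈)

data SquareEdge (n : ℕ) : ℕ × ℕ → Set where
  spine : ∀ j → j < n → SquareEdge n (j , suc j)
  rise  : ∀ j → j < n → SquareEdge n (suc j , n + suc j)
  top   : ∀ j → j < n → SquareEdge n (n + suc j , n + n + suc j)
  fall  : ∀ j → j < n → SquareEdge n (n + n + suc j , j)

squareEdgeOf : ∀ {n e} → e ∈ edges (orthoChain n) → SquareEdge n e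
squareEdgeOf {n} e∈ with find (∈-concatMap⁻ (squareEdges n) {xs = upTo n} e∈)
... | j , j∈ , here refl                         = spine j (∈-upTo⁻ j∈)
... | j , j∈ , there (here refl)                 = rise j (∈-upTo⁻ j∈)
... | j , j∈ , there (there (here refl))         = top j (∈-upTo⁻ j∈)
... | j , j∈ , there (there (there (here refl))) = fall j (∈-upTo⁻ j∈)

endpoints : ∀ {n e} → SquareEdge n e → VertexOf n (proj₁ e) × VertexOf n (proj₂ e)
endpoints (spine j j<n) = isC j (<⇒≤ j<n) , isC (suc j) j<n
endpoints (rise j j<n)  = isC (suc j) j<n , isX j j<n
endpoints (top j j<n)   = isX j j<n , isY j j<n
endpoints (fall j j<n)  = isY j j<n , isC j (<⇒≤ j<n)

leftOf : ℕ → Pt → Bool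
leftOf j W = pos W <ᵇ suc j

inSquare : ℕ → Pt → Bool
inSquare j W = offSpine W ∧ (square W ≡ᵇ suc j)

separates-spine : ∀ {n j} → j < n → Separates (coords n j) (coords n (suc j)) (leftOf j)
separates-spine {j = j} j<n
  rewrite coords-vertex (isC j (<⇒≤ j<n)) | coords-vertex (isC (suc j) j<n) = separates-along j false 0

separates-top : ∀ {n j} → j < n → Separates (coords n (n + n + suc j)) (coords n (n + suc j)) (leftOf j)
separates-top {j = j} j<n
  rewrite coords-vertex (isY j j<n) | coords-vertex (isX j j<n) = separates-along j true (suc j)

separates-rise : ∀ {n j} → j < n → Separates (coords n (n + suc j)) (coords n (suc j)) (inSquare j)
separates-rise {j = j} j<n
  rewrite coords-vertex (isX j j<n) | coords-vertex (isC (suc j) j<n) = separates-above (suc j) (suc j)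

separates-fall : ∀ {n j} → j < n → Separates (coords n (n + n + suc j)) (coords n j) (inSquare j)
separates-fall {j = j} j<n
  rewrite coords-vertex (isY j j<n) | coords-vertex (isC j (<⇒≤ j<n)) = separates-above j (suc j)

coordDist-edge : ∀ {n e} → SquareEdge n e → ∀ v →
  coordDist n (proj₁ e) v ≤ suc (coordDist n (proj₂ e) v) × coordDist n (proj₂ e) v ≤ suc (coordDist n (proj₁ e) v)
coordDist-edge (spine j j<n) _ = separates-lipschitz (separates-spine j<n) _
coordDist-edge (rise j j<n)  _ = swap (separates-lipschitz (separates-rise j<n) _)
coordDist-edge (top j j<n)   _ = swap (separates-lipschitz (separates-top j<n) _)
coordDist-edge (fall j j<n)  _ = separates-lipschitz (separates-fall j<n) _

coordDist-self : ∀ n u → coordDist n u u ≡ 0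
coordDist-self n u = δ-self (coords n u)

coordDist≡0⇒≡ : ∀ {n u v} → VertexOf n u → VertexOf n v → coordDist n u v ≡ 0 → u ≡ v
coordDist≡0⇒≡ {n} cu cv d≡0 = δ≡0 cu cv (subst₂ (λ P Q → δ P Q ≡ 0) (coords-vertex cu) (coords-vertex cv) d≡0)
  where
  δ≡0 : ∀ {u v} (cu : VertexOf n u) (cv : VertexOf n v) → δ (coordsOf cu) (coordsOf cv) ≡ 0 → u ≡ v
  δ≡0 (isC j _) (isC j′ _) eq = ∣m-n∣≡0⇒m≡n (trans (sym (+-identityʳ _)) eq)
  δ≡0 (isC j _) (isX j′ _) eq with () ← m+n≡0⇒n≡0 ∣ j - suc j′ ∣ eq
  δ≡0 (isC j _) (isY j′ _) eq with () ← m+n≡0⇒n≡0 ∣ j - j′ ∣ eq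
  δ≡0 (isX j _) (isC j′ _) eq with () ← m+n≡0⇒n≡0 ∣ suc j - j′ ∣ eq
  δ≡0 (isY j _) (isC j′ _) eq with () ← m+n≡0⇒n≡0 ∣ j - j′ ∣ eq
  δ≡0 (isX j _) (isX j′ _) eq = cong (λ i → n + suc i) (∣m-n∣≡0⇒m≡n (m+n≡0⇒m≡0 ∣ j - j′ ∣ eq))
  δ≡0 (isY j _) (isY j′ _) eq = cong (λ i → n + n + suc i) (∣m-n∣≡0⇒m≡n (m+n≡0⇒m≡0 ∣ j - j′ ∣ eq))
  δ≡0 (isX j _) (isY j′ _) eq with refl ← ∣m-n∣≡0⇒m≡n {suc j} {j′} (m+n≡0⇒m≡0 ∣ suc j - j′ ∣ eq)
    rewrite ∣n-n∣≡0 (suc j) | ≡ᵇ-false {j} {suc j} (λ e → 1+n≢n (sym e)) with () ← eq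
  δ≡0 (isY j _) (isX j′ _) eq with refl ← ∣m-n∣≡0⇒m≡n {j} {suc j′} (m+n≡0⇒m≡0 ∣ j - suc j′ ∣ eq)
    rewrite ∣n-n∣≡0 (suc j′) | ≡ᵇ-false (1+n≢n {j′}) with () ← eq

spine∈ : ∀ {n j} → j < n → (j , suc j) ∈ edges (orthoChain n)
spine∈ j<n = ∈-squareEdges _ j<n (here refl)

rise∈ : ∀ {n j} → j < n → (suc j , n + suc j) ∈ edges (orthoChain n)
rise∈ j<n = ∈-squareEdges _ j<n (there (here refl))

top∈ : ∀ {n j} → j < n → (n + suc j , n + n + suc j) ∈ edges (orthoChain n)
top∈ j<n = ∈-squareEdges _ j<n (there (there (here refl)))

fall∈ : ∀ {n j} → j < n → (n + n + suc j , j) ∈ edges (orthoChain n)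
fall∈ j<n = ∈-squareEdges _ j<n (there (there (there (here refl))))

-- Distances in O_n

Adjacent : ℕ → ℕ → ℕ → Set
Adjacent n u w = (u , w) ∈ edges (orthoChain n) ⊎ (w , u) ∈ edges (orthoChain n)

Descent : ℕ → ℕ → ℕ → ℕ → Set
Descent n u v k = ∃[ w ] Adjacent n u w × coordDist n w v ≡ k

descend-towards : ∀ {n u w v k S} (cv : VertexOf n v) → Adjacent n u w →
  Separates (coords n u) (coords n w) S → S (coordsOf cv) ≡ false → coordDist n u v ≡ suc k → Descent n u v k
descend-towards {n} {v = v} {S = S} cv adj sep Sv d =
  _ , adj , suc-injective (trans (sym (separates-false sep (coords n v) (trans (cong S (coords-vertex cv)) Sv))) d)

descend-back : ∀ {n u w v k S} (cv : VertexOf n v) → Adjacent n u w →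
  Separates (coords n w) (coords n u) S → S (coordsOf cv) ≡ true → coordDist n u v ≡ suc k → Descent n u v k
descend-back {n} {v = v} {S = S} cv adj sep Sv d =
  _ , adj , suc-injective (trans (sym (separates-true sep (coords n v) (trans (cong S (coords-vertex cv)) Sv))) d)

coordDist-self≢suc : ∀ n u {k} → coordDist n u u ≢ suc k
coordDist-self≢suc n u d with () ← trans (sym (coordDist-self n u)) d

descent-c : ∀ {n j v k} → j ≤ n → (cv : VertexOf n v) → coordDist n j v ≡ suc k → Descent n j v k
descent-c {j = j} _ cv d with <-cmp j (pos (coordsOf cv))
... | tri< j<p _ _ =
  let j<n = <-≤-trans j<p (pos≤n cv) in
  descend-towards cv (inj₁ (spine∈ j<n)) (separates-spine j<n) (<ᵇ-false j<p) d
descent-c {j = suc i} 1+i≤n cv d | tri> _ _ p<1+i =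
  descend-back cv (inj₂ (spine∈ 1+i≤n)) (separates-spine 1+i≤n) (<ᵇ-true p<1+i) d
descent-c {n} {j} _ (isC _ _) d | tri≈ _ refl _ = ⊥-elim (coordDist-self≢suc n j d)
descent-c _ (isX i i<n) d | tri≈ _ refl _ =
  descend-back (isX i i<n) (inj₁ (rise∈ i<n)) (separates-rise i<n) (≡ᵇ-refl i) d
descent-c _ (isY j j<n) d | tri≈ _ refl _ =
  descend-back (isY j j<n) (inj₂ (fall∈ j<n)) (separates-fall j<n) (≡ᵇ-refl j) d

descent-x : ∀ {n j v k} → j < n → (cv : VertexOf n v) → coordDist n (n + suc j) v ≡ suc k → Descent n (n + suc j) v k
descent-x j<n cv@(isC _ _) d = descend-towards cv (inj₂ (rise∈ j<n)) (separates-rise j<n) refl d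
descent-x {n} {j} j<n cv@(isX i _) d with i ≟ j
... | yes refl = ⊥-elim (coordDist-self≢suc n (n + suc j) d)
... | no i≢j   = descend-towards cv (inj₂ (rise∈ j<n)) (separates-rise j<n) (≡ᵇ-false i≢j) d
descent-x {j = j} j<n cv@(isY i _) d with i ≟ j
... | yes refl = descend-back cv (inj₁ (top∈ j<n)) (separates-top j<n) (<ᵇ-true (n<1+n j)) d
... | no i≢j   = descend-towards cv (inj₂ (rise∈ j<n)) (separates-rise j<n) (≡ᵇ-false i≢j) d

descent-y : ∀ {n j v k} → j < n → (cv : VertexOf n v) → coordDist n (n + n + suc j) v ≡ suc k → Descent n (n + n + suc j) v k
descent-y j<n cv@(isC _ _) d = descend-towards cv (inj₁ (fall∈ j<n)) (separates-fall j<n) refl d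
descent-y {n} {j} j<n cv@(isY i _) d with i ≟ j
... | yes refl = ⊥-elim (coordDist-self≢suc n (n + n + suc j) d)
... | no i≢j   = descend-towards cv (inj₁ (fall∈ j<n)) (separates-fall j<n) (≡ᵇ-false i≢j) d
descent-y {j = j} j<n cv@(isX i _) d with i ≟ j
... | yes refl = descend-towards cv (inj₂ (top∈ j<n)) (separates-top j<n) (<ᵇ-false (≤-refl {suc j})) d
... | no i≢j   = descend-towards cv (inj₁ (fall∈ j<n)) (separates-fall j<n) (≡ᵇ-false i≢j) d

descent : ∀ {n u v k} → VertexOf n u → VertexOf n v → coordDist n u v ≡ suc k → Descent n u v k
descent (isC _ j≤n) = descent-c j≤n
descent (isX _ j<n) = descent-x j<n
descent (isY _ j<n) = descent-y j<n

walkStep : ℕ → ℕ → ℕ → ℕ → ℕ × ℕ → Bool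
walkStep n k u v e =
  ((proj₁ e ≡ᵇ u) ∧ (coordDist n (proj₂ e) v ≤ᵇ k)) ∨ ((proj₂ e ≡ᵇ u) ∧ (coordDist n (proj₁ e) v ≤ᵇ k))

walkStep-descent : ∀ {n k u v} → Descent n u v k → any (walkStep n k u v) (edges (orthoChain n)) ≡ true
walkStep-descent {n} {k} {u} {v} (w , inj₁ uw∈ , d) = to T-≡ (any⁺ _ (lose uw∈ (from T-≡ step)))
  where
  step : walkStep n k u v (u , w) ≡ true
  step rewrite ≡ᵇ-refl u | d | ≤ᵇ-true (≤-refl {k}) = refl
walkStep-descent {n} {k} {u} {v} (w , inj₂ wu∈ , d) = to T-≡ (any⁺ _ (lose wu∈ (from T-≡ step)))
  where
  step : walkStep n k u v (w , u) ≡ true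
  step rewrite ≡ᵇ-refl u | d | ≤ᵇ-true (≤-refl {k}) = ∨-zeroʳ _

walkStep⇒close : ∀ {n k u v e} → e ∈ edges (orthoChain n) → T (walkStep n k u v e) → coordDist n u v ≤ suc k
walkStep⇒close {n} {k} {u} {v} {a , b} e∈ t with to T-∨ t
... | inj₁ t₁ with a≡u , b-near ← to T-∧ t₁ with refl ← ≡ᵇ⇒≡ a u a≡u =
  ≤-trans (proj₁ (coordDist-edge (squareEdgeOf e∈) v)) (s≤s (≤ᵇ⇒≤ (coordDist n b v) k b-near))
... | inj₂ t₂ with b≡u , a-near ← to T-∧ t₂ with refl ← ≡ᵇ⇒≡ b u b≡u =
  ≤-trans (proj₂ (coordDist-edge (squareEdgeOf e∈) v)) (s≤s (≤ᵇ⇒≤ (coordDist n a v) k a-near))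

walkStep-far : ∀ {n k u v} → suc k < coordDist n u v → any (walkStep n k u v) (edges (orthoChain n)) ≡ false
walkStep-far {n} {k} {u} {v} far with any (walkStep n k u v) (edges (orthoChain n)) in eq
... | false = refl
... | true with _ , e∈ , t ← find (any⁻ (walkStep n k u v) _ (from T-≡ eq)) =
  ⊥-elim (<⇒≱ far (walkStep⇒close {n} {k} {u} {v} e∈ t))

walkWithin-step : ∀ {n k u v} → VertexOf n u → VertexOf n v →
  ((coordDist n u v ≤ᵇ k) ∨ any (walkStep n k u v) (edges (orthoChain n))) ≡ (coordDist n u v ≤ᵇ suc k)
walkWithin-step {n} {k} {u} {v} cu cv with <-cmp (coordDist n u v) (suc k)
... | tri< near _ _ rewrite ≤ᵇ-true (≤-pred near) | ≤ᵇ-true (<⇒≤ near) = refl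
... | tri≈ _ d _ =
  trans (cong₂ _∨_ (≤ᵇ-false {coordDist n u v} (≤-reflexive (sym d))) (walkStep-descent {n} {k} {u} {v} (descent cu cv d)))
        (sym (≤ᵇ-true (≤-reflexive d)))
... | tri> _ _ far =
  trans (cong₂ _∨_ (≤ᵇ-false {coordDist n u v} (<-trans (n<1+n k) far)) (walkStep-far {n} {k} {u} {v} far))
        (sym (≤ᵇ-false {coordDist n u v} far))

walkWithin-coordDist : ∀ n k {u v} → VertexOf n u → VertexOf n v →
  walkWithin (orthoChain n) k u v ≡ (coordDist n u v ≤ᵇ k)
walkWithin-coordDist n zero {u} {v} cu cv with u ≟ v
... | yes refl rewrite ≡ᵇ-refl u | coordDist-self n u = refl
... | no u≢v with coordDist n u v in d
...   | zero  = ⊥-elim (u≢v (coordDist≡0⇒≡ cu cv d))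
...   | suc _ = ≡ᵇ-false u≢v
walkWithin-coordDist n (suc k) {u} {v} cu cv =
  trans (cong₂ _∨_ (walkWithin-coordDist n k cu cv) (cong or (map-cong-local (tabulate step))))
        (walkWithin-step cu cv)
  where
  step : ∀ {e} → e ∈ edges (orthoChain n) →
    (((proj₁ e ≡ᵇ u) ∧ walkWithin (orthoChain n) k (proj₂ e) v) ∨ ((proj₂ e ≡ᵇ u) ∧ walkWithin (orthoChain n) k (proj₁ e) v))
    ≡ walkStep n k u v e
  step e∈ with ca , cb ← endpoints (squareEdgeOf e∈)
    rewrite walkWithin-coordDist n k ca cv | walkWithin-coordDist n k cb cv = refl

coordDist≤ : ∀ {n u v} → 1 ≤ n → VertexOf n u → VertexOf n v → coordDist n u v ≤ 3 * n + 1
coordDist≤ {n} 1≤n cu cv rewrite coords-vertex cu | coords-vertex cv = begin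
  δ (coordsOf cu) (coordsOf cv)   ≤⟨ +-mono-≤ (≤-trans (∣m-n∣≤m⊔n P.pos Q.pos) (⊔-lub (pos≤n cu) (pos≤n cv)))
                                        (detour≤2 P.offSpine P.square Q.offSpine Q.square) ⟩
  n + 2                           ≤⟨ +-monoʳ-≤ n (s≤s (≤-trans 1≤n (m≤m+n n (n + 0)))) ⟩
  n + suc (n + (n + 0))           ≡⟨ e n ⟩
  3 * n + 1                       ∎
  where
  open ≤-Reasoning
  module P = Pt (coordsOf cu)
  module Q = Pt (coordsOf cv)
  e : ∀ n → n + suc (n + (n + 0)) ≡ 3 * n + 1
  e = solve-∀

dist≡coordDist : ∀ {n u v} → 1 ≤ n → VertexOf n u → VertexOf n v → dist (orthoChain n) u v ≡ coordDist n u v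
dist≡coordDist {n} {u} {v} 1≤n cu cv = begin
  dist (orthoChain n) u v                                   ≡⟨ countL-sumBelow _ (3 * n + 1) ⟩
  sumBelow (λ i → toℕ (not (walkWithin (orthoChain n) i u v))) (3 * n + 1)
    ≡⟨ sumBelow-cong (3 * n + 1) (λ i _ → cong toℕ (trans (cong not (walkWithin-coordDist n i cu cv))
                                                             (not-≤ᵇ (coordDist n u v) i))) ⟩
  sumBelow (λ i → toℕ (i <ᵇ coordDist n u v)) (3 * n + 1)  ≡⟨ sumBelow-<ᵇ (coordDist n u v) (3 * n + 1) ⟩
  (3 * n + 1) ⊓ coordDist n u v                            ≡⟨ m≥n⇒m⊓n≡n (coordDist≤ 1≤n cu cv) ⟩
  coordDist n u v                                           ∎
  where
  open ≡-Reasoning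
  not-≤ᵇ : ∀ d k → not (d ≤ᵇ k) ≡ (k <ᵇ d)
  not-≤ᵇ d k with k <? d
  ... | yes k<d rewrite ≤ᵇ-false k<d | <ᵇ-true k<d = refl
  ... | no k≮d rewrite ≤ᵇ-true (≮⇒≥ k≮d) | <ᵇ-false (≮⇒≥ k≮d) = refl

-- Counting closer vertices and edges

countVertices : ℕ → (Pt → Bool) → ℕ
countVertices n S = sumBelow (λ i → toℕ (S (coords n i))) (3 * n + 1)

countEdges : ℕ → (Pt → Bool) → ℕ
countEdges n S = sum (map (λ f → toℕ (S (coords n (proj₁ f)) ∧ S (coords n (proj₂ f)))) (edges (orthoChain n)))

nVert-separates : ∀ {n a b S} → 1 ≤ n → VertexOf n a → VertexOf n b →
  Separates (coords n a) (coords n b) S → nVert (orthoChain n) a b ≡ countVertices n S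
nVert-separates {n} {a} {b} {S} 1≤n ca cb sep = trans (countL-sumBelow _ (3 * n + 1)) (sumBelow-cong (3 * n + 1) closer)
  where
  closer : ∀ i → i < 3 * n + 1 → toℕ (dist (orthoChain n) i a <ᵇ dist (orthoChain n) i b) ≡ toℕ (S (coords n i))
  closer i i<3n+1 with ci ← vertexOf {n} i<3n+1
    rewrite dist≡coordDist 1≤n ci ca | dist≡coordDist 1≤n ci cb = cong toℕ (offByOne-<ᵇ (sep (coords n i)))

mEdge-separates : ∀ {n a b S} → 1 ≤ n → VertexOf n a → VertexOf n b →
  Separates (coords n a) (coords n b) S → mEdge (orthoChain n) a b ≡ countEdges n S
mEdge-separates {n} {a} {b} {S} 1≤n ca cb sep = trans (countL-sum _ (edges (orthoChain n))) (sum-map-cong _ closer)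
  where
  closer : ∀ {f} → f ∈ edges (orthoChain n) →
    toℕ (distVE (orthoChain n) a f <ᵇ distVE (orthoChain n) b f) ≡ toℕ (S (coords n (proj₁ f)) ∧ S (coords n (proj₂ f)))
  closer {f₁ , f₂} f∈ with c₁ , c₂ ← endpoints (squareEdgeOf f∈)
    rewrite dist≡coordDist 1≤n ca c₁ | dist≡coordDist 1≤n ca c₂ | dist≡coordDist 1≤n cb c₁ | dist≡coordDist 1≤n cb c₂
          | δ-sym (coords n a) (coords n f₁) | δ-sym (coords n a) (coords n f₂)
          | δ-sym (coords n b) (coords n f₁) | δ-sym (coords n b) (coords n f₂) =
    cong toℕ (min-offByOne (sep (coords n f₁)) (sep (coords n f₂))
      (proj₁ (f-lipschitz a)) (proj₂ (f-lipschitz a)) (proj₁ (f-lipschitz b)) (proj₂ (f-lipschitz b)))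
    where
    f-lipschitz : ∀ v → coordDist n f₁ v ≤ suc (coordDist n f₂ v) × coordDist n f₂ v ≤ suc (coordDist n f₁ v)
    f-lipschitz = coordDist-edge (squareEdgeOf f∈)

countVertices-split : ∀ n S → countVertices n S ≡
  sumBelow (λ i → toℕ (S (pt i false 0))) (suc n) + sumBelow (λ i → toℕ (S (pt (suc i) true (suc i)))) n
    + sumBelow (λ i → toℕ (S (pt i true (suc i)))) n
countVertices-split n S = begin
  sumBelow f (3 * n + 1)                                                  ≡⟨ cong (sumBelow f) (e n) ⟩
  sumBelow f (suc n + n + n)                                              ≡⟨ sumBelow-split f (suc n + n) n ⟩
  sumBelow f (suc n + n) + sumBelow (λ i → f (suc n + n + i)) n
    ≡⟨ cong (_+ sumBelow (λ i → f (suc n + n + i)) n) (sumBelow-split f (suc n) n) ⟩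
  sumBelow f (suc n) + sumBelow (λ i → f (suc n + i)) n + sumBelow (λ i → f (suc n + n + i)) n
    ≡⟨ cong₂ _+_ (cong₂ _+_ (sumBelow-cong (suc n) onC) (sumBelow-cong n onX)) (sumBelow-cong n onY) ⟩
  _                                                                       ∎
  where
  open ≡-Reasoning
  f : ℕ → ℕ
  f i = toℕ (S (coords n i))
  e : ∀ n → 3 * n + 1 ≡ suc n + n + n
  e = solve-∀
  onC : ∀ i → i < suc n → f i ≡ toℕ (S (pt i false 0))
  onC i i<1+n = cong (toℕ ∘ S) (coords-vertex (isC i (≤-pred i<1+n)))
  onX : ∀ i → i < n → f (suc n + i) ≡ toℕ (S (pt (suc i) true (suc i)))
  onX i i<n = cong (toℕ ∘ S) (trans (cong (coords n) (sym (+-suc n i))) (coords-vertex (isX i i<n)))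
  onY : ∀ i → i < n → f (suc n + n + i) ≡ toℕ (S (pt i true (suc i)))
  onY i i<n = cong (toℕ ∘ S) (trans (cong (coords n) (sym (+-suc (n + n) i))) (coords-vertex (isY i i<n)))

countVertices-not : ∀ n S → countVertices n (not ∘ S) ≡ (3 * n + 1) ∸ countVertices n S
countVertices-not n S = sumBelow-complement (λ i → S (coords n i)) (3 * n + 1)

countVertices-leftOf : ∀ {n j} → j < n → countVertices n (leftOf j) ≡ 2 + 3 * j
countVertices-leftOf {n} {j} j<n = begin
  countVertices n (leftOf j)                  ≡⟨ countVertices-split n (leftOf j) ⟩
  sumBelow (λ i → toℕ (i <ᵇ suc j)) (suc n) + sumBelow (λ i → toℕ (i <ᵇ j)) n + sumBelow (λ i → toℕ (i <ᵇ suc j)) n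
    ≡⟨ cong₂ _+_ (cong₂ _+_ (sumBelow-<ᵇ (suc j) (suc n)) (sumBelow-<ᵇ j n)) (sumBelow-<ᵇ (suc j) n) ⟩
  suc n ⊓ suc j + n ⊓ j + n ⊓ suc j
    ≡⟨ cong₂ _+_ (cong₂ _+_ (m≥n⇒m⊓n≡n (m≤n⇒m≤1+n j<n)) (m≥n⇒m⊓n≡n (<⇒≤ j<n))) (m≥n⇒m⊓n≡n j<n) ⟩
  suc j + j + suc j                           ≡⟨ e j ⟩
  2 + 3 * j                                   ∎
  where
  open ≡-Reasoning
  e : ∀ j → suc j + j + suc j ≡ 2 + 3 * j
  e = solve-∀

countVertices-inSquare : ∀ {n j} → j < n → countVertices n (inSquare j) ≡ 2
countVertices-inSquare {n} {j} j<n = trans (countVertices-split n (inSquare j))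
  (cong₂ _+_ (cong₂ _+_ (trans (sumBelow-const 0 (suc n)) (*-zeroʳ (suc n))) (sumBelow-≡ᵇ j n j<n)) (sumBelow-≡ᵇ j n j<n))

both : (Pt → Bool) → Pt → Pt → ℕ
both S P Q = toℕ (S P ∧ S Q)

-- The four edges c_i c_{i+1}, c_{i+1} x_{i+1}, x_{i+1} y_{i+1}, y_{i+1} c_i of S_{i+1}.
squareIndicator : (Pt → Bool) → ℕ → ℕ
squareIndicator S i =
  both S (pt i false 0) (pt (suc i) false 0) + (both S (pt (suc i) false 0) (pt (suc i) true (suc i))
    + (both S (pt (suc i) true (suc i)) (pt i true (suc i)) + (both S (pt i true (suc i)) (pt i false 0) + 0)))

countEdges-squares : ∀ n S → countEdges n S ≡ sumBelow (squareIndicator S) n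
countEdges-squares n S = begin
  countEdges n S                                       ≡⟨ sum-concatMap _ (squareEdges n) (upTo n) ⟩
  sum (map (λ i → sum (map f (squareEdges n i))) (upTo n)) ≡⟨ sum-upTo _ n ⟩
  sumBelow (λ i → sum (map f (squareEdges n i))) n     ≡⟨ sumBelow-cong n onSquare ⟩
  sumBelow (squareIndicator S) n                       ∎
  where
  open ≡-Reasoning
  f : ℕ × ℕ → ℕ
  f e = toℕ (S (coords n (proj₁ e)) ∧ S (coords n (proj₂ e)))
  onSquare : ∀ i → i < n → sum (map f (squareEdges n i)) ≡ squareIndicator S i
  onSquare i i<n rewrite coords-vertex (isC i (<⇒≤ i<n)) | coords-vertex (isC (suc i) i<n)
                     | coords-vertex (isX i i<n) | coords-vertex (isY i i<n) = refl

sumBelow-<ᵇ-≤ : ∀ {m N} → m ≤ N → sumBelow (λ i → toℕ (i <ᵇ m)) N ≡ m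
sumBelow-<ᵇ-≤ {m} {N} m≤N = trans (sumBelow-<ᵇ m N) (m≥n⇒m⊓n≡n m≤N)

sumBelow-≮ᵇ-≤ : ∀ {m N} → m ≤ N → sumBelow (λ i → toℕ (not (i <ᵇ m))) N ≡ N ∸ m
sumBelow-≮ᵇ-≤ {m} {N} m≤N = trans (sumBelow-complement (_<ᵇ m) N) (cong (N ∸_) (sumBelow-<ᵇ-≤ m≤N))

countEdges-leftOf : ∀ {n j} → j < n → countEdges n (leftOf j) ≡ 1 + 4 * j
countEdges-leftOf {n} {j} j<n = begin
  countEdges n (leftOf j)                                   ≡⟨ countEdges-squares n (leftOf j) ⟩
  sumBelow (squareIndicator (leftOf j)) n
    ≡⟨ sumBelow-cong n (λ i _ → chain (i <ᵇ suc j) (i <ᵇ j) (below⇒below-suc i)) ⟩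
  sumBelow (λ i → 3 * toℕ (i <ᵇ j) + toℕ (i <ᵇ suc j)) n    ≡⟨ sumBelow-+ _ _ n ⟩
  sumBelow (λ i → 3 * toℕ (i <ᵇ j)) n + sumBelow (λ i → toℕ (i <ᵇ suc j)) n
    ≡⟨ cong₂ _+_ (trans (sumBelow-*ˡ 3 _ n) (cong (3 *_) (sumBelow-<ᵇ-≤ (<⇒≤ j<n)))) (sumBelow-<ᵇ-≤ j<n) ⟩
  3 * j + suc j                                             ≡⟨ e j ⟩
  1 + 4 * j                                                 ∎
  where
  open ≡-Reasoning
  chain : ∀ a b → (b ≡ true → a ≡ true) →
    toℕ (a ∧ b) + (toℕ (b ∧ b) + (toℕ (b ∧ a) + (toℕ (a ∧ a) + 0))) ≡ 3 * toℕ b + toℕ a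
  chain true  true  _ = refl
  chain true  false _ = refl
  chain false true  b⇒a with () ← b⇒a refl
  chain false false _ = refl
  below⇒below-suc : ∀ i → (i <ᵇ j) ≡ true → (i <ᵇ suc j) ≡ true
  below⇒below-suc i i<ᵇj = <ᵇ-true (m≤n⇒m≤1+n (<ᵇ⇒< i j (from T-≡ i<ᵇj)))
  e : ∀ j → 3 * j + suc j ≡ 1 + 4 * j
  e = solve-∀

countEdges-not-leftOf : ∀ j r → countEdges (suc (j + r)) (not ∘ leftOf j) ≡ 1 + 4 * r
countEdges-not-leftOf j r = begin
  countEdges n (not ∘ leftOf j)                             ≡⟨ countEdges-squares n (not ∘ leftOf j) ⟩
  sumBelow (squareIndicator (not ∘ leftOf j)) n
    ≡⟨ sumBelow-cong n (λ i _ → chain (not (i <ᵇ suc j)) (not (i <ᵇ j)) (not-below-suc⇒not-below i)) ⟩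
  sumBelow (λ i → 3 * toℕ (not (i <ᵇ suc j)) + toℕ (not (i <ᵇ j))) n ≡⟨ sumBelow-+ _ _ n ⟩
  sumBelow (λ i → 3 * toℕ (not (i <ᵇ suc j))) n + sumBelow (λ i → toℕ (not (i <ᵇ j))) n
    ≡⟨ cong₂ _+_ (trans (sumBelow-*ˡ 3 _ n) (cong (3 *_) (sumBelow-≮ᵇ-≤ j<n))) (sumBelow-≮ᵇ-≤ (<⇒≤ j<n)) ⟩
  3 * (n ∸ suc j) + (n ∸ j)                                 ≡⟨ cong₂ (λ a b → 3 * a + b) (m+n∸m≡n j r) (+-∸-assoc 1 (m≤m+n j r)) ⟩
  3 * r + suc (j + r ∸ j)                                   ≡⟨ cong (λ a → 3 * r + suc a) (m+n∸m≡n j r) ⟩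
  3 * r + suc r                                             ≡⟨ e r ⟩
  1 + 4 * r                                                 ∎
  where
  open ≡-Reasoning
  n : ℕ
  n = suc (j + r)
  j<n : j < n
  j<n = s≤s (m≤m+n j r)
  chain : ∀ a b → (a ≡ true → b ≡ true) →
    toℕ (a ∧ b) + (toℕ (b ∧ b) + (toℕ (b ∧ a) + (toℕ (a ∧ a) + 0))) ≡ 3 * toℕ a + toℕ b
  chain true  true  _ = refl
  chain true  false a⇒b with () ← a⇒b refl
  chain false true  _ = refl
  chain false false _ = refl
  not-below-suc⇒not-below : ∀ i → not (i <ᵇ suc j) ≡ true → not (i <ᵇ j) ≡ true
  not-below-suc⇒not-below i i≮ᵇ1+j with i <? j
  ... | yes i<j rewrite <ᵇ-true (m≤n⇒m≤1+n i<j) with () ← i≮ᵇ1+j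
  ... | no i≮j rewrite <ᵇ-false (≮⇒≥ i≮j) = refl
  e : ∀ r → 3 * r + suc r ≡ 1 + 4 * r
  e = solve-∀

countEdges-inSquare : ∀ {n j} → j < n → countEdges n (inSquare j) ≡ 1
countEdges-inSquare {n} {j} j<n =
  trans (countEdges-squares n (inSquare j)) (trans (sumBelow-cong n (λ i _ → single (i ≡ᵇ j))) (sumBelow-≡ᵇ j n j<n))
  where
  single : ∀ e → toℕ false + (toℕ (false ∧ e) + (toℕ (e ∧ e) + (toℕ (e ∧ false) + 0))) ≡ toℕ e
  single true  = refl
  single false = refl

countEdges-not-inSquare : ∀ j r → countEdges (suc (j + r)) (not ∘ inSquare j) ≡ 1 + 4 * (j + r)
countEdges-not-inSquare j r = begin
  countEdges n (not ∘ inSquare j)                           ≡⟨ countEdges-squares n (not ∘ inSquare j) ⟩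
  sumBelow (squareIndicator (not ∘ inSquare j)) n           ≡⟨ sumBelow-cong n (λ i _ → allBut (i ≡ᵇ j)) ⟩
  sumBelow (λ i → 1 + 3 * toℕ (not (i ≡ᵇ j))) n             ≡⟨ sumBelow-+ _ _ n ⟩
  sumBelow (λ _ → 1) n + sumBelow (λ i → 3 * toℕ (not (i ≡ᵇ j))) n
    ≡⟨ cong₂ _+_ (trans (sumBelow-const 1 n) (*-identityʳ n)) (sumBelow-*ˡ 3 _ n) ⟩
  n + 3 * sumBelow (λ i → toℕ (not (i ≡ᵇ j))) n
    ≡⟨ cong (λ a → n + 3 * a) (trans (sumBelow-complement (_≡ᵇ j) n) (cong (n ∸_) (sumBelow-≡ᵇ j n (s≤s (m≤m+n j r))))) ⟩
  n + 3 * (j + r)                                           ≡⟨ e (j + r) ⟩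
  1 + 4 * (j + r)                                           ∎
  where
  open ≡-Reasoning
  n : ℕ
  n = suc (j + r)
  allBut : ∀ e → toℕ (true ∧ true) + (toℕ (true ∧ not e) + (toℕ (not e ∧ not e) + (toℕ (not e ∧ true) + 0)))
                 ≡ 1 + 3 * toℕ (not e)
  allBut true  = refl
  allBut false = refl
  e : ∀ m → suc m + 3 * m ≡ 1 + 4 * m
  e = solve-∀

countVertices-not-leftOf : ∀ j r → countVertices (suc (j + r)) (not ∘ leftOf j) ≡ 2 + 3 * r
countVertices-not-leftOf j r = begin
  countVertices n (not ∘ leftOf j)              ≡⟨ countVertices-not n (leftOf j) ⟩
  3 * n + 1 ∸ countVertices n (leftOf j)        ≡⟨ cong₂ _∸_ (e j r) (countVertices-leftOf (s≤s (m≤m+n j r))) ⟩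
  (2 + 3 * j) + (2 + 3 * r) ∸ (2 + 3 * j)       ≡⟨ m+n∸m≡n (2 + 3 * j) (2 + 3 * r) ⟩
  2 + 3 * r                                     ∎
  where
  open ≡-Reasoning
  n : ℕ
  n = suc (j + r)
  e : ∀ j r → 3 * suc (j + r) + 1 ≡ (2 + 3 * j) + (2 + 3 * r)
  e = solve-∀

countVertices-not-inSquare : ∀ j r → countVertices (suc (j + r)) (not ∘ inSquare j) ≡ 2 + 3 * (j + r)
countVertices-not-inSquare j r = begin
  countVertices n (not ∘ inSquare j)            ≡⟨ countVertices-not n (inSquare j) ⟩
  3 * n + 1 ∸ countVertices n (inSquare j)      ≡⟨ cong₂ _∸_ (e (j + r)) (countVertices-inSquare (s≤s (m≤m+n j r))) ⟩
  2 + (2 + 3 * (j + r)) ∸ 2                     ≡⟨ m+n∸m≡n 2 (2 + 3 * (j + r)) ⟩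
  2 + 3 * (j + r)                               ∎
  where
  open ≡-Reasoning
  n : ℕ
  n = suc (j + r)
  e : ∀ m → 3 * suc m + 1 ≡ 2 + (2 + 3 * m)
  e = solve-∀

-- Contribution of one square

squareImbalance : (ℕ → ℕ → ℕ) → ℕ → ℕ → ℕ
squareImbalance t n j = sum (map (λ e → ∣ t (proj₁ e) (proj₂ e) - t (proj₂ e) (proj₁ e) ∣) (squareEdges n j))

squareImbalance-separated : ∀ (t : ℕ → ℕ → ℕ) (count : (Pt → Bool) → ℕ) {n j} → j < n →
  (∀ {a b S} → VertexOf n a → VertexOf n b → Separates (coords n a) (coords n b) S → t a b ≡ count S) →
  squareImbalance t n j
    ≡ 2 * (∣ count (leftOf j) - count (not ∘ leftOf j) ∣ + ∣ count (inSquare j) - count (not ∘ inSquare j) ∣)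
squareImbalance-separated t count {n} {j} j<n t≡count
  rewrite t≡count (isC j (<⇒≤ j<n)) (isC (suc j) j<n) (separates-spine j<n)
        | t≡count (isC (suc j) j<n) (isC j (<⇒≤ j<n)) (separates-swap (separates-spine j<n))
        | t≡count (isX j j<n) (isC (suc j) j<n) (separates-rise j<n)
        | t≡count (isC (suc j) j<n) (isX j j<n) (separates-swap (separates-rise j<n))
        | t≡count (isY j j<n) (isX j j<n) (separates-top j<n)
        | t≡count (isX j j<n) (isY j j<n) (separates-swap (separates-top j<n))
        | t≡count (isY j j<n) (isC j (<⇒≤ j<n)) (separates-fall j<n)
        | t≡count (isC j (<⇒≤ j<n)) (isY j j<n) (separates-swap (separates-fall j<n)) =
  twice (count (leftOf j)) (count (not ∘ leftOf j)) (count (inSquare j)) (count (not ∘ inSquare j))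
  where
  twice : ∀ a b c d → ∣ a - b ∣ + (∣ d - c ∣ + (∣ b - a ∣ + (∣ c - d ∣ + 0))) ≡ 2 * (∣ a - b ∣ + ∣ c - d ∣)
  twice a b c d rewrite ∣-∣-comm d c | ∣-∣-comm b a = solve (∣ a - b ∣) (∣ c - d ∣)
    where
    solve : ∀ p q → p + (q + (p + (q + 0))) ≡ 2 * (p + q)
    solve = solve-∀

m≤n⇒∣m-n∣+[m+n]≡2n : ∀ {m n} → m ≤ n → ∣ m - n ∣ + (m + n) ≡ 2 * n
m≤n⇒∣m-n∣+[m+n]≡2n {m} m≤n with d , refl ← m≤n⇒∃[o]m+o≡n m≤n rewrite ∣m-m+n∣≡n m d = e m d
  where
  e : ∀ m d → d + (m + (m + d)) ≡ 2 * (m + d)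
  e = solve-∀

∣m-n∣+[m+n]≡2[m⊔n] : ∀ m n → ∣ m - n ∣ + (m + n) ≡ 2 * (m ⊔ n)
∣m-n∣+[m+n]≡2[m⊔n] m n with ≤-total m n
... | inj₁ m≤n rewrite m≤n⇒m⊔n≡n m≤n = m≤n⇒∣m-n∣+[m+n]≡2n m≤n
... | inj₂ n≤m rewrite m≥n⇒m⊔n≡m n≤m | ∣-∣-comm m n | +-comm m n = m≤n⇒∣m-n∣+[m+n]≡2n n≤m

squareImbalance-from-counts : ∀ (t : ℕ → ℕ → ℕ) (count : (Pt → Bool) → ℕ) k c j r →
  (∀ {a b S} → VertexOf (suc (j + r)) a → VertexOf (suc (j + r)) b →
     Separates (coords (suc (j + r)) a) (coords (suc (j + r)) b) S → t a b ≡ count S) →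
  count (leftOf j) ≡ k + c * j → count (not ∘ leftOf j) ≡ k + c * r →
  count (inSquare j) ≡ k → count (not ∘ inSquare j) ≡ k + c * (j + r) →
  squareImbalance t (suc (j + r)) j ≡ 4 * c * (j ⊔ r)
squareImbalance-from-counts t count k c j r t≡count left right inside outside = begin
  squareImbalance t (suc (j + r)) j
    ≡⟨ squareImbalance-separated t count (s≤s (m≤m+n j r)) t≡count ⟩
  2 * (∣ count (leftOf j) - count (not ∘ leftOf j) ∣ + ∣ count (inSquare j) - count (not ∘ inSquare j) ∣)
    ≡⟨ cong₂ (λ a b → 2 * (a + b)) (cong₂ ∣_-_∣ left right) (cong₂ ∣_-_∣ inside outside) ⟩
  2 * (∣ k + c * j - k + c * r ∣ + ∣ k - k + c * (j + r) ∣)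
    ≡⟨ cong (λ a → 2 * (a + ∣ k - k + c * (j + r) ∣))
            (trans (∣m+n-m+o∣≡∣n-o∣ k (c * j) (c * r)) (sym (*-distribˡ-∣-∣ c j r))) ⟩
  2 * (c * ∣ j - r ∣ + ∣ k - k + c * (j + r) ∣)  ≡⟨ cong (λ a → 2 * (c * ∣ j - r ∣ + a)) (∣m-m+n∣≡n k (c * (j + r))) ⟩
  2 * (c * ∣ j - r ∣ + c * (j + r))             ≡⟨ cong (2 *_) (sym (*-distribˡ-+ c ∣ j - r ∣ (j + r))) ⟩
  2 * (c * (∣ j - r ∣ + (j + r)))               ≡⟨ cong (λ a → 2 * (c * a)) (∣m-n∣+[m+n]≡2[m⊔n] j r) ⟩
  2 * (c * (2 * (j ⊔ r)))                       ≡⟨ e c (j ⊔ r) ⟩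
  4 * c * (j ⊔ r)                               ∎
  where
  open ≡-Reasoning
  e : ∀ c m → 2 * (c * (2 * m)) ≡ 4 * c * m
  e = solve-∀

squareMostar : ∀ j r → squareImbalance (nVert (orthoChain (suc (j + r)))) (suc (j + r)) j ≡ 12 * (j ⊔ r)
squareMostar j r = squareImbalance-from-counts _ (countVertices (suc (j + r))) 2 3 j r (nVert-separates (s≤s z≤n))
  (countVertices-leftOf (s≤s (m≤m+n j r))) (countVertices-not-leftOf j r)
  (countVertices-inSquare (s≤s (m≤m+n j r))) (countVertices-not-inSquare j r)

squareEdgeMostar : ∀ j r → squareImbalance (mEdge (orthoChain (suc (j + r)))) (suc (j + r)) j ≡ 16 * (j ⊔ r)
squareEdgeMostar j r = squareImbalance-from-counts _ (countEdges (suc (j + r))) 1 4 j r (mEdge-separates (s≤s z≤n))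
  (countEdges-leftOf (s≤s (m≤m+n j r))) (countEdges-not-leftOf j r)
  (countEdges-inSquare (s≤s (m≤m+n j r))) (countEdges-not-inSquare j r)

-- Summing over the squares

longerSide : ℕ → ℕ → ℕ
longerSide n j = j ⊔ (n ∸ suc j)

longerSides : ℕ → ℕ
longerSides n = sumBelow (longerSide n) n

sumBelow-squares : ∀ (f : ℕ → ℕ → ℕ) c → (∀ j r → f (suc (j + r)) j ≡ c * (j ⊔ r)) →
  ∀ n → sumBelow (f n) n ≡ c * longerSides n
sumBelow-squares f c square n = trans (sumBelow-cong n onSquare) (sumBelow-*ˡ c (longerSide n) n)
  where
  onSquare : ∀ j → j < n → f n j ≡ c * longerSide n j
  onSquare j j<n with r , refl ← m≤n⇒∃[o]m+o≡n j<n rewrite m+n∸m≡n j r = square j r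

imbalance-squares : ∀ (t : ℕ → ℕ → ℕ) n →
  sum (map (λ e → ∣ t (proj₁ e) (proj₂ e) - t (proj₂ e) (proj₁ e) ∣) (edges (orthoChain n)))
    ≡ sumBelow (squareImbalance t n) n
imbalance-squares t n = trans (sum-concatMap _ (squareEdges n) (upTo n)) (sum-upTo (squareImbalance t n) n)

Mo-orthoChain : ∀ n → Mo (orthoChain n) ≡ 12 * longerSides n
Mo-orthoChain n = trans (imbalance-squares (nVert (orthoChain n)) n)
  (sumBelow-squares (λ m → squareImbalance (nVert (orthoChain m)) m) 12 squareMostar n)

Moe-orthoChain : ∀ n → Moe (orthoChain n) ≡ 16 * longerSides n
Moe-orthoChain n = trans (imbalance-squares (mEdge (orthoChain n)) n)
  (sumBelow-squares (λ m → squareImbalance (mEdge (orthoChain m)) m) 16 squareEdgeMostar n)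

-- The squares at both ends of O_{n+2} see n+1 further squares, and each inner
-- square sees one more than the corresponding square of O_n.
longerSides-suc-suc : ∀ n → longerSides (suc (suc n)) ≡ longerSides n + (3 * n + 2)
longerSides-suc-suc n = begin
  sumBelow f (suc (suc n))                     ≡⟨ cong (_+ f (suc n)) (sumBelow-suc f n) ⟩
  suc n + sumBelow (f ∘ suc) n + f (suc n)     ≡⟨ cong₂ (λ a b → suc n + a + b) (sumBelow-cong n inner) last ⟩
  suc n + sumBelow (λ j → suc (longerSide n j)) n + suc n
    ≡⟨ cong (λ a → suc n + a + suc n) (trans (sumBelow-+ (λ _ → 1) (longerSide n) n)
                                            (cong (_+ longerSides n) (trans (sumBelow-const 1 n) (*-identityʳ n)))) ⟩
  suc n + (n + longerSides n) + suc n          ≡⟨ e n (longerSides n) ⟩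
  longerSides n + (3 * n + 2)                  ∎
  where
  open ≡-Reasoning
  f : ℕ → ℕ
  f = longerSide (suc (suc n))
  inner : ∀ j → j < n → f (suc j) ≡ suc (longerSide n j)
  inner j j<n = cong (suc j ⊔_) (+-∸-assoc 1 j<n)
  last : f (suc n) ≡ suc n
  last rewrite n∸n≡0 n = ⊔-identityʳ (suc n)
  e : ∀ n l → suc n + (n + l) + suc n ≡ l + (3 * n + 2)
  e = solve-∀

longerSides-even : ∀ k → longerSides (2 * k) + k ≡ 3 * k * k
longerSides-even zero    = refl
longerSides-even (suc k) = begin
  longerSides (2 * suc k) + suc k                ≡⟨ cong (λ m → longerSides m + suc k) (e₁ k) ⟩
  longerSides (suc (suc (2 * k))) + suc k        ≡⟨ cong (_+ suc k) (longerSides-suc-suc (2 * k)) ⟩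
  longerSides (2 * k) + (3 * (2 * k) + 2) + suc k ≡⟨ e₂ (longerSides (2 * k)) k ⟩
  longerSides (2 * k) + k + (6 * k + 3)          ≡⟨ cong (_+ (6 * k + 3)) (longerSides-even k) ⟩
  3 * k * k + (6 * k + 3)                        ≡⟨ e₃ k ⟩
  3 * suc k * suc k                              ∎
  where
  open ≡-Reasoning
  e₁ : ∀ k → 2 * suc k ≡ suc (suc (2 * k))
  e₁ = solve-∀
  e₂ : ∀ l k → l + (3 * (2 * k) + 2) + suc k ≡ l + k + (6 * k + 3)
  e₂ = solve-∀
  e₃ : ∀ k → 3 * k * k + (6 * k + 3) ≡ 3 * suc k * suc k
  e₃ = solve-∀

longerSides-odd : ∀ k → longerSides (2 * k + 1) ≡ 3 * k * k + 2 * k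
longerSides-odd zero    = refl
longerSides-odd (suc k) = begin
  longerSides (2 * suc k + 1)                    ≡⟨ cong longerSides (e₁ k) ⟩
  longerSides (suc (suc (2 * k + 1)))            ≡⟨ longerSides-suc-suc (2 * k + 1) ⟩
  longerSides (2 * k + 1) + (3 * (2 * k + 1) + 2) ≡⟨ cong (_+ (3 * (2 * k + 1) + 2)) (longerSides-odd k) ⟩
  3 * k * k + 2 * k + (3 * (2 * k + 1) + 2)      ≡⟨ e₂ k ⟩
  3 * suc k * suc k + 2 * suc k                  ∎
  where
  open ≡-Reasoning
  e₁ : ∀ k → 2 * suc k + 1 ≡ suc (suc (2 * k + 1))
  e₁ = solve-∀
  e₂ : ∀ k → 3 * k * k + 2 * k + (3 * (2 * k + 1) + 2) ≡ 3 * suc k * suc k + 2 * suc k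
  e₂ = solve-∀

scaled-even : ∀ c k → c * longerSides (2 * k) ≡ c * 3 * k * k ∸ c * k
scaled-even c k = sym (begin
  c * 3 * k * k ∸ c * k                          ≡⟨ cong (_∸ c * k) (e c k) ⟩
  c * (3 * k * k) ∸ c * k                        ≡⟨ cong (λ a → c * a ∸ c * k) (sym (longerSides-even k)) ⟩
  c * (longerSides (2 * k) + k) ∸ c * k          ≡⟨ cong (_∸ c * k) (*-distribˡ-+ c (longerSides (2 * k)) k) ⟩
  c * longerSides (2 * k) + c * k ∸ c * k        ≡⟨ m+n∸n≡m (c * longerSides (2 * k)) (c * k) ⟩
  c * longerSides (2 * k)                        ∎)
  where
  open ≡-Reasoning
  e : ∀ c k → c * 3 * k * k ≡ c * (3 * k * k)
  e = solve-∀

scaled-odd : ∀ c k → c * longerSides (2 * k + 1) ≡ c * 3 * k * k + c * 2 * k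
scaled-odd c k = trans (cong (c *_) (longerSides-odd k)) (e c k)
  where
  e : ∀ c k → c * (3 * k * k + 2 * k) ≡ c * 3 * k * k + c * 2 * k
  e = solve-∀

mainTheorem12 : (n k : ℕ) → 1 ≤ k →
    ((n ≡ 2 * k →
        (Mo (orthoChain n) ≡ 36 * k * k ∸ 12 * k) × (Moe (orthoChain n) ≡ 48 * k * k ∸ 16 * k))
    × (n ≡ 2 * k + 1 →
        (Mo (orthoChain n) ≡ 36 * k * k + 24 * k) × (Moe (orthoChain n) ≡ 48 * k * k + 32 * k)))
mainTheorem12 n k _ = even , odd
  where
  even : n ≡ 2 * k → (Mo (orthoChain n) ≡ 36 * k * k ∸ 12 * k) × (Moe (orthoChain n) ≡ 48 * k * k ∸ 16 * k)
  even refl = trans (Mo-orthoChain n) (scaled-even 12 k) , trans (Moe-orthoChain n) (scaled-even 16 k)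
  odd : n ≡ 2 * k + 1 → (Mo (orthoChain n) ≡ 36 * k * k + 24 * k) × (Moe (orthoChain n) ≡ 48 * k * k + 32 * k)
  odd refl = trans (Mo-orthoChain n) (scaled-odd 12 k) , trans (Moe-orthoChain n) (scaled-odd 16 k)
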